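{- Let $\mathcal F$ be a class of Kripke frames over a finite alphabet $\mathrm{Al}$. The modal depth of the logic $\mathrm{Log}\,\mathcal F$ is finite if and only if the modal depth of $\mathcal F$ is finite.
   Context: $\mathrm{Log}\,\mathcal F$ is the set of formulas valid in all frames of $\mathcal F$. Modal depth of a logic: $\mathrm{md}(\varphi)$ is the maximal nesting of modalities in $\varphi$; $\mathrm{md}_L(\varphi)=\min\{\mathrm{md}(\psi):\varphi\leftrightarrow\psi\in L\}$; $\mathrm{md}(L)=\sup_\varphi\mathrm{md}_L(\varphi)$. Modal depth of a Kripke frame $F=(X,(R_\Diamond)_{\Diamond\in\mathrm{Al}})$: for $\mathcal V\subseteq\mathcal P(X)$, $a\equiv_{\mathcal V}b$ iff $\forall V\in\mathcal V\,(a\in V\Leftrightarrow b\in V)$; $\sim_{\mathcal V,0}=\equiv_{\mathcal V}$, $\mathcal V_0=X/{\sim_{\mathcal V,0}}$; for $d\ge1$, $\sim_{\mathcal V,d}$ is induced by $\mathcal V_{d-1}\cup\{R_\Diamond^{ -1}[V]:\Diamond\in\mathrm{Al},V\in\mathcal V_{d-1}\}$, $\mathcal V_d=X/{\sim_{\mathcal V,d}}$, $\mathcal V_\omega=\bigcup_d\mathcal V_d$; $\mathrm{md}(V)=\min\{d:V\in\mathcal V_d\}$; $\mathrm{md}(\mathcal V)=\sup_{V\in\mathcal V_\omega}\mathrm{md}(V)$; $\mathrm{md}(F)=\sup\{\mathrm{md}(\mathcal V):\mathcal V\subseteq\mathcal P(X)$ finite$\}$; $\mathrm{md}(\mathcal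 F)=\sup_{F\in\mathcal F}\mathrm{md}(F)$. -}

module Defs where

open import Level using (Level; _⊔_) renaming (suc to lsuc; zero to lzero)
open import Data.Nat using (ℕ; zero; suc; _≤_) renaming (_⊔_ to _⊔ℕ_)
open import Data.Fin using (Fin)
open import Data.Product using (Σ; _×_; ∃; ∃-syntax)
open import Data.Empty using (⊥)
open import Function.Bundles using (_⇔_)

-- Modal formulas over the finite alphabet Al = Fin k, variables ℕ.
-- Primitive connectives: ⊥, →, ∧, ◇ᵢ (the rest is definable classically).

data Fm (k : ℕ) : Set where
  var  : ℕ → Fm k
  ⊥f   : Fm k
  _⇒_  : Fm k → Fm k → Fm k
  _∧f_ : Fm k → Fm k → Fm k
  ◇    : Fin k → Fm k → Fm k

_⇔f_ : ∀ {k} → Fm k → Fm k → Fm k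
φ ⇔f ψ = (φ ⇒ ψ) ∧f (ψ ⇒ φ)

md : ∀ {k} → Fm k → ℕ
md (var _)  = 0
md ⊥f       = 0
md (φ ⇒ ψ)  = md φ ⊔ℕ md ψ
md (φ ∧f ψ) = md φ ⊔ℕ md ψ
md (◇ _ φ)  = suc (md φ)

record Frame (k : ℕ) : Set₁ where
  field
    X : Set
    R : Fin k → X → X → Set

module _ {k : ℕ} (F : Frame k) where
  open Frame F

  Valuation : Set₁
  Valuation = ℕ → X → Set

  Sat : Valuation → X → Fm k → Set
  Sat θ x (var p)  = θ p x
  Sat θ x ⊥f       = ⊥
  Sat θ x (φ ⇒ ψ)  = Sat θ x φ → Sat θ x ψ
  Sat θ x (φ ∧f ψ) = Sat θ x φ × Sat θ x ψ
  Sat θ x (◇ i φ)  = Σ X λ y → R i x y × Sat θ y φ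

  Valid : Fm k → Set₁
  Valid φ = (θ : Valuation) (x : X) → Sat θ x φ

  module _ {m : ℕ} (𝒱 : Fin m → X → Set) where

    -- Sim d a b  is  a ∼_{𝒱,d} b.
    -- d = 0 : a ≡_𝒱 b.
    -- d+1   : ≡ w.r.t. 𝒱_d ∪ {R_i⁻¹[V] : V ∈ 𝒱_d}, where the members of
    --         𝒱_d are the classes [c]_d = {b | Sim d c b}, written out.
    Sim : ℕ → X → X → Set
    Sim zero a b = (j : Fin m) → (𝒱 j a ⇔ 𝒱 j b)
    Sim (suc d) a b =
      ((c : X) → (Sim d c a ⇔ Sim d c b)) ×
      ((i : Fin k) (c : X) →
         (Σ X λ a' → R i a a' × Sim d c a') ⇔ (Σ X λ b' → R i b b' × Sim d c b'))

    InLevel : ℕ → (X → Set) → Set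
    InLevel d V = Σ X λ c → (b : X) → (V b ⇔ Sim d c b)

    MdFamilyLe : ℕ → Set₁
    MdFamilyLe n = (d : ℕ) (V : X → Set) → InLevel d V →
                   Σ ℕ λ d' → d' ≤ n × InLevel d' V

  MdFrameLe : ℕ → Set₁
  MdFrameLe n = (m : ℕ) (𝒱 : Fin m → X → Set) → MdFamilyLe 𝒱 n

Log : ∀ {k ℓ} → (Frame k → Set ℓ) → Fm k → Set (lsuc lzero ⊔ ℓ)
Log 𝓕 φ = ∀ F → 𝓕 F → Valid F φ

LogicDepthFinite : ∀ {k ℓ} → (Frame k → Set ℓ) → Set (lsuc lzero ⊔ ℓ)
LogicDepthFinite {k} 𝓕 =
  ∃[ n ] ((φ : Fm k) → Σ (Fm k) λ ψ → md ψ ≤ n × Log 𝓕 (φ ⇔f ψ))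

ClassDepthFinite : ∀ {k ℓ} → (Frame k → Set ℓ) → Set (lsuc lzero ⊔ ℓ)
ClassDepthFinite 𝓕 = ∃[ n ] (∀ F → 𝓕 F → MdFrameLe F n)

{-# OPTIONS --safe #-}
-- Read a finite family 𝒱 as a valuation of the variables below m.  Then a ∼_{𝒱,d} b says
-- exactly that a and b satisfy the same depth-≤ d formulas in these variables, and these are,
-- up to equivalence, finitely many Boolean combinations of Hintikka formulas.  So md(F) ≤ n
-- means that ∼_n already refines every ∼_d.
--
-- If every formula is Log 𝓕-equivalent to one of depth ≤ N, then on F ∈ 𝓕 the depth-d
-- Hintikka formula of a point is equivalent to a depth-N formula, so ∼_N refines ∼_d.
--
-- Conversely, let md(F) ≤ n for all F ∈ 𝓕.  The n-type of a point then determines every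
-- formula true there.  Taking the valuation {a}, the set of n-types of points reaching a within
-- j steps grows strictly until it stops growing, so every F is pretransitive with a bound H
-- that depends only on n.  If x and y agree up to depth H + n + 1, then "reachable within H
-- steps and of the same n-type" is a bisimulation between x and y.  So every φ is equivalent
-- over 𝓕 to the disjunction of the depth-(H + n + 1) Hintikka formulas realised together with φ.
module Submission where

open import Defs
open import Level using (Level; Lift; lift; lower) renaming (suc to lsuc; zero to lzero)
open import Data.Nat using (ℕ; zero; suc; _≤_; _<_; _≤′_; ≤′-refl; ≤′-step; z≤n; s≤s; _+_; _≤?_; _<?_)
  renaming (_⊔_ to _⊔ℕ_)
open import Data.Nat.Properties
  using (≤-refl; ≤-trans; ≤-<-trans; m≤n⇒m≤1+n; n≤1+n; m≤n+m; m⊔n≤o⇒m≤o; m⊔n≤o⇒n≤o; m≤m⊔n; m≤n⊔m;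
         ⊔-lub; ⊔-mono-≤; ≤⇒≤′; ≤′⇒≤; ≰⇒>; <⇒≤; <-irrefl)
open import Data.Fin using (Fin; toℕ; fromℕ<)
open import Data.Fin.Properties using (toℕ<n; toℕ-injective; toℕ-fromℕ<)
open import Data.List using (List; []; _∷_; _++_; map; concatMap; length; filter; upTo; allFin)
open import Data.List.Relation.Unary.All as All using (All; []; _∷_)
open import Data.List.Relation.Unary.All.Properties using ()
  renaming (++⁺ to All-++⁺; map⁺ to All-map⁺; concat⁺ to All-concat⁺; filter⁺ to All-filter⁺)
open import Data.List.Relation.Unary.Any using (Any; here; there; satisfied)
open import Data.List.Relation.Unary.Any.Properties using () renaming (map⁻ to Any-map⁻)
open import Data.List.Properties using (length-filter)
open import Data.List.Membership.Propositional using (_∈_; lose; find)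
open import Data.List.Membership.Propositional.Properties
  using (∈-map⁺; ∈-map⁻; ∈-++⁺ˡ; ∈-++⁺ʳ; ∈-++⁻; ∈-allFin; ∈-upTo⁺; ∈-upTo⁻; ∈-concatMap⁺;
         ∈-filter⁺; ∈-filter⁻)
open import Data.Product using (Σ; _×_; _,_; proj₁; proj₂)
open import Data.Product.Function.NonDependent.Propositional using (_×-⇔_)
open import Data.Sum using (_⊎_; inj₁; inj₂)
open import Data.Unit using (⊤; tt)
open import Data.Empty using (⊥-elim)
open import Function using (_∘_)
open import Function.Bundles using (_⇔_; mk⇔; Equivalence)
import Function.Properties.Equivalence as ⇔
open import Function.Related.TypeIsomorphisms using (→-cong-⇔)
open import Relation.Nullary using (¬_; Dec; yes; no; contradiction)
open import Relation.Nullary.Decidable using (decidable-stable)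
open import Relation.Unary using (Pred; Decidable; _⊆_)
open import Relation.Binary.PropositionalEquality using (_≡_; refl; subst)
open import Axiom.ExcludedMiddle using (ExcludedMiddle)

open Equivalence using (to; from)

module _ {a p q} {A : Set a} {P : Pred A p} {Q : Pred A q}
         (P? : Decidable P) (Q? : Decidable Q) (P⊆Q : P ⊆ Q) where

  length-filter-mono : ∀ xs → length (filter P? xs) ≤ length (filter Q? xs)
  length-filter-mono [] = z≤n
  length-filter-mono (x ∷ xs) with P? x | Q? x
  ... | yes _  | yes _  = s≤s (length-filter-mono xs)
  ... | yes px | no ¬qx = contradiction (P⊆Q px) ¬qx
  ... | no _   | yes _  = m≤n⇒m≤1+n (length-filter-mono xs)
  ... | no _   | no _   = length-filter-mono xs

  length-filter-strict : ∀ {x xs} → x ∈ xs → Q x → ¬ P x →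
                         length (filter P? xs) < length (filter Q? xs)
  length-filter-strict {xs = y ∷ xs} (here refl) qx ¬px with P? y | Q? y
  ... | yes px | _      = contradiction px ¬px
  ... | no _   | yes _  = s≤s (length-filter-mono xs)
  ... | no _   | no ¬qx = contradiction qx ¬qx
  length-filter-strict {xs = y ∷ xs} (there x∈) qx ¬px with P? y | Q? y
  ... | yes _  | yes _  = s≤s (length-filter-strict x∈ qx ¬px)
  ... | yes py | no ¬qy = contradiction (P⊆Q py) ¬qy
  ... | no _   | yes _  = m≤n⇒m≤1+n (length-filter-strict x∈ qx ¬px)
  ... | no _   | no _   = length-filter-strict x∈ qx ¬px

familyValuation : ∀ {X : Set} {m} → (Fin m → X → Set) → ℕ → X → Set
familyValuation {m = m} 𝒱 p x = Σ (Fin m) λ j → toℕ j ≡ p × 𝒱 j x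

module _ {X : Set} {m : ℕ} (𝒱 : Fin m → X → Set) where

  familyValuation-encodes : ∀ j x → 𝒱 j x ⇔ familyValuation 𝒱 (toℕ j) x
  familyValuation-encodes j x =
    mk⇔ (λ v → j , refl , v) (λ (j' , e , v) → subst (λ j → 𝒱 j x) (toℕ-injective e) v)

  familyValuation-vanishes : ∀ p x → ¬ p < m → ¬ familyValuation 𝒱 p x
  familyValuation-vanishes p x p≮m (j , refl , _) = p≮m (toℕ<n j)

module _ {k : ℕ} where

  ¬f : Fm k → Fm k
  ¬f φ = φ ⇒ ⊥f

  ⊤f : Fm k
  ⊤f = ¬f ⊥f

  _∨f_ : Fm k → Fm k → Fm k
  φ ∨f ψ = ¬f φ ⇒ ψ

  ⋁ : List (Fm k) → Fm k
  ⋁ [] = ⊥f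
  ⋁ (φ ∷ φs) = φ ∨f ⋁ φs

  ◇some : Fm k → Fm k
  ◇some φ = ⋁ (map (λ i → ◇ i φ) (allFin k))

  ◇≤ : ℕ → Fm k → Fm k
  ◇≤ zero    φ = φ
  ◇≤ (suc j) φ = φ ∨f ◇some (◇≤ j φ)

  VarsBelow : ℕ → Fm k → Set
  VarsBelow m (var p)  = p < m
  VarsBelow m ⊥f       = ⊤
  VarsBelow m (φ ⇒ ψ)  = VarsBelow m φ × VarsBelow m ψ
  VarsBelow m (φ ∧f ψ) = VarsBelow m φ × VarsBelow m ψ
  VarsBelow m (◇ i φ)  = VarsBelow m φ

  Bounded : ℕ → ℕ → Fm k → Set
  Bounded m d φ = md φ ≤ d × VarsBelow m φ

  maxVar : Fm k → ℕ
  maxVar (var p)  = p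
  maxVar ⊥f       = 0
  maxVar (φ ⇒ ψ)  = maxVar φ ⊔ℕ maxVar ψ
  maxVar (φ ∧f ψ) = maxVar φ ⊔ℕ maxVar ψ
  maxVar (◇ i φ)  = maxVar φ

  maxVar<⇒VarsBelow : ∀ φ {m} → maxVar φ < m → VarsBelow m φ
  maxVar<⇒VarsBelow (var p)  h = h
  maxVar<⇒VarsBelow ⊥f       h = tt
  maxVar<⇒VarsBelow (φ ⇒ ψ)  h =
    maxVar<⇒VarsBelow φ (≤-<-trans (m≤m⊔n _ _) h) , maxVar<⇒VarsBelow ψ (≤-<-trans (m≤n⊔m _ _) h)
  maxVar<⇒VarsBelow (φ ∧f ψ) h =
    maxVar<⇒VarsBelow φ (≤-<-trans (m≤m⊔n _ _) h) , maxVar<⇒VarsBelow ψ (≤-<-trans (m≤n⊔m _ _) h)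
  maxVar<⇒VarsBelow (◇ i φ)  h = maxVar<⇒VarsBelow φ h

  truncateVars : ℕ → Fm k → Fm k
  truncateVars m (var p) with p <? m
  ... | yes _ = var p
  ... | no _  = ⊥f
  truncateVars m ⊥f       = ⊥f
  truncateVars m (φ ⇒ ψ)  = truncateVars m φ ⇒ truncateVars m ψ
  truncateVars m (φ ∧f ψ) = truncateVars m φ ∧f truncateVars m ψ
  truncateVars m (◇ i φ)  = ◇ i (truncateVars m φ)

  md-truncateVars : ∀ m φ → md (truncateVars m φ) ≤ md φ
  md-truncateVars m (var p) with p <? m
  ... | yes _ = z≤n
  ... | no _  = z≤n
  md-truncateVars m ⊥f       = z≤n
  md-truncateVars m (φ ⇒ ψ)  = ⊔-mono-≤ (md-truncateVars m φ) (md-truncateVars m ψ)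
  md-truncateVars m (φ ∧f ψ) = ⊔-mono-≤ (md-truncateVars m φ) (md-truncateVars m ψ)
  md-truncateVars m (◇ i φ)  = s≤s (md-truncateVars m φ)

  VarsBelow-truncateVars : ∀ m φ → VarsBelow m (truncateVars m φ)
  VarsBelow-truncateVars m (var p) with p <? m
  ... | yes p<m = p<m
  ... | no _    = tt
  VarsBelow-truncateVars m ⊥f       = tt
  VarsBelow-truncateVars m (φ ⇒ ψ)  = VarsBelow-truncateVars m φ , VarsBelow-truncateVars m ψ
  VarsBelow-truncateVars m (φ ∧f ψ) = VarsBelow-truncateVars m φ , VarsBelow-truncateVars m ψ
  VarsBelow-truncateVars m (◇ i φ)  = VarsBelow-truncateVars m φ

  record BooleanClosed {ℓ} (Q : Fm k → Set ℓ) : Set ℓ where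
    field
      ⊥-closed : Q ⊥f
      ⇒-closed : ∀ {φ ψ} → Q φ → Q ψ → Q (φ ⇒ ψ)
      ∧-closed : ∀ {φ ψ} → Q φ → Q ψ → Q (φ ∧f ψ)

    ¬-closed : ∀ {φ} → Q φ → Q (¬f φ)
    ¬-closed q = ⇒-closed q ⊥-closed

    ⋁-closed : ∀ {φs} → All Q φs → Q (⋁ φs)
    ⋁-closed []       = ⊥-closed
    ⋁-closed (q ∷ qs) = ⇒-closed (¬-closed q) (⋁-closed qs)

  open BooleanClosed public

  md≤-closed : ∀ d → BooleanClosed (λ φ → md φ ≤ d)
  md≤-closed d = record { ⊥-closed = z≤n ; ⇒-closed = ⊔-lub ; ∧-closed = ⊔-lub }

  VarsBelow-closed : ∀ m → BooleanClosed (VarsBelow m)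
  VarsBelow-closed m = record { ⊥-closed = tt ; ⇒-closed = _,_ ; ∧-closed = _,_ }

  Bounded-closed : ∀ m d → BooleanClosed (Bounded m d)
  Bounded-closed m d = record
    { ⊥-closed = z≤n , tt
    ; ⇒-closed = λ (h , v) (h' , v') → ⊔-lub h h' , v , v'
    ; ∧-closed = λ (h , v) (h' , v') → ⊔-lub h h' , v , v'
    }

  md-◇some : ∀ {φ c} → md φ ≤ c → md (◇some φ) ≤ suc c
  md-◇some {c = c} h = ⋁-closed (md≤-closed (suc c)) (All-map⁺ (All.universal (λ _ → s≤s h) (allFin k)))

  md-◇≤ : ∀ j {φ c} → md φ ≤ c → md (◇≤ j φ) ≤ j + c
  md-◇≤ zero    h = h
  md-◇≤ (suc j) {c = c} h = ⊔-lub (⊔-lub (≤-trans h (m≤n+m c (suc j))) z≤n) (md-◇some (md-◇≤ j h))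

  VarsBelow-◇≤ : ∀ j {m φ} → VarsBelow m φ → VarsBelow m (◇≤ j φ)
  VarsBelow-◇≤ zero    v = v
  VarsBelow-◇≤ (suc j) {m} v =
    (v , tt) ,
    ⋁-closed (VarsBelow-closed m) (All-map⁺ (All.universal (λ _ → VarsBelow-◇≤ j v) (allFin k)))

  profiles : List (Fm k) → List (Fm k)
  profiles []       = ⊤f ∷ []
  profiles (φ ∷ φs) = map (φ ∧f_) (profiles φs) ++ map (¬f φ ∧f_) (profiles φs)

  profiles-closed : ∀ {ℓ} {Q : Fm k → Set ℓ} → BooleanClosed Q → ∀ {φs} → All Q φs → All Q (profiles φs)
  profiles-closed bc []       = ⇒-closed bc (⊥-closed bc) (⊥-closed bc) ∷ []
  profiles-closed bc (q ∷ qs) =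
    All-++⁺ (All-map⁺ (All.map (∧-closed bc q) ih)) (All-map⁺ (All.map (∧-closed bc (¬-closed bc q)) ih))
    where ih = profiles-closed bc qs

  vars : ℕ → List (Fm k)
  vars m = map var (upTo m)

  diamonds : List (Fm k) → List (Fm k)
  diamonds φs = concatMap (λ i → map (◇ i) φs) (allFin k)

  ◇∈diamonds : ∀ {φ φs} i → φ ∈ φs → ◇ i φ ∈ diamonds φs
  ◇∈diamonds {φs = φs} i φ∈ =
    ∈-concatMap⁺ (λ j → map (◇ j) φs) (lose (∈-allFin i) (∈-map⁺ (◇ i) φ∈))

  -- A point's depth-(d+1) type in the variables below m is fixed by its variables and by
  -- which depth-d types it sees along each Rᵢ.
  basis : ℕ → ℕ → List (Fm k)
  basis m zero    = vars m
  basis m (suc d) = vars m ++ diamonds (profiles (basis m d))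

  var∈basis : ∀ {m p} d → p < m → var p ∈ basis m d
  var∈basis zero    p<m = ∈-map⁺ var (∈-upTo⁺ p<m)
  var∈basis (suc d) p<m = ∈-++⁺ˡ (∈-map⁺ var (∈-upTo⁺ p<m))

  hintikkas : ℕ → ℕ → List (Fm k)
  hintikkas m d = profiles (basis m d)

  hintikkas-bounded : ∀ m d → All (Bounded m d) (hintikkas m d)
  hintikkas-bounded m d = profiles-closed (Bounded-closed m d) (basis-bounded d)
    where
    vars-bounded : ∀ {d} → All (Bounded m d) (vars m)
    vars-bounded = All-map⁺ (All.tabulate (λ p∈ → z≤n , ∈-upTo⁻ p∈))
    basis-bounded : ∀ d → All (Bounded m d) (basis m d)
    basis-bounded zero    = vars-bounded
    basis-bounded (suc d) = All-++⁺ vars-bounded (All-concat⁺ (All-map⁺ (All.universal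
      (λ i → All-map⁺ (All.map (λ (h , v) → s≤s h , v) (hintikkas-bounded m d))) (allFin k))))

  module _ (F : Frame k) where
    open Frame F

    data Reach≤ : ℕ → X → X → Set where
      done : ∀ {j x} → Reach≤ j x x
      step : ∀ {j x y z} i → R i x y → Reach≤ j y z → Reach≤ (suc j) x z

    Reach≤-suc : ∀ {j x z} → Reach≤ j x z → Reach≤ (suc j) x z
    Reach≤-suc done         = done
    Reach≤-suc (step i r p) = step i r (Reach≤-suc p)

    Reach≤-mono : ∀ {j j' x z} → j ≤ j' → Reach≤ j x z → Reach≤ j' x z
    Reach≤-mono {j} {x = x} {z} le p = go (≤⇒≤′ le)
      where
      go : ∀ {j'} → j ≤′ j' → Reach≤ j' x z
      go ≤′-refl       = p
      go (≤′-step le′) = Reach≤-suc (go le′)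

    Reach≤-snoc : ∀ {j x y z i} → Reach≤ j x y → R i y z → Reach≤ (suc j) x z
    Reach≤-snoc done          r = step _ r done
    Reach≤-snoc (step i r' p) r = step i r' (Reach≤-snoc p r)

    module _ (θ : Valuation F) where

      ⋁-intro : ∀ {x} φs → Any (Sat F θ x) φs → Sat F θ x (⋁ φs)
      ⋁-intro (φ ∷ φs) (here s)  ¬s = contradiction s ¬s
      ⋁-intro (φ ∷ φs) (there s) _  = ⋁-intro φs s

      ◇some-intro : ∀ {x y φ} i → R i x y → Sat F θ y φ → Sat F θ x (◇some φ)
      ◇some-intro i r s = ⋁-intro _ (lose (∈-map⁺ (λ i → ◇ i _) (∈-allFin i)) (_ , r , s))

      ◇≤-intro : ∀ j {x w φ} → Reach≤ j x w → Sat F θ w φ → Sat F θ x (◇≤ j φ)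
      ◇≤-intro zero    done         s = s
      ◇≤-intro (suc j) done         s ¬s = contradiction s ¬s
      ◇≤-intro (suc j) (step i r p) s _  = ◇some-intro i r (◇≤-intro j p s)

      Sat-truncateVars : ∀ m → (∀ p x → ¬ p < m → ¬ θ p x) →
                         ∀ φ x → Sat F θ x (truncateVars m φ) ⇔ Sat F θ x φ
      Sat-truncateVars m empty (var p) x with p <? m
      ... | yes _  = ⇔.refl
      ... | no p≮m = mk⇔ (λ ()) (empty p x p≮m)
      Sat-truncateVars m empty ⊥f       x = ⇔.refl
      Sat-truncateVars m empty (φ ⇒ ψ)  x =
        →-cong-⇔ (Sat-truncateVars m empty φ x) (Sat-truncateVars m empty ψ x)
      Sat-truncateVars m empty (φ ∧f ψ) x =
        Sat-truncateVars m empty φ x ×-⇔ Sat-truncateVars m empty ψ x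
      Sat-truncateVars m empty (◇ i φ)  x =
        mk⇔ (λ (y , r , s) → y , r , to (Sat-truncateVars m empty φ y) s)
            (λ (y , r , s) → y , r , from (Sat-truncateVars m empty φ y) s)

  Agree : ℕ → ℕ → (F : Frame k) → Valuation F → Frame.X F →
                   (G : Frame k) → Valuation G → Frame.X G → Set
  Agree m d F θ x G η y = ∀ φ → VarsBelow m φ → md φ ≤ d → Sat F θ x φ ⇔ Sat G η y φ

  Agreeω : ℕ → (F : Frame k) → Valuation F → Frame.X F →
               (G : Frame k) → Valuation G → Frame.X G → Set
  Agreeω m F θ x G η y = ∀ φ → VarsBelow m φ → Sat F θ x φ ⇔ Sat G η y φ

  module _ {m d : ℕ} {F G : Frame k} {θ : Valuation F} {η : Valuation G}
           {x : Frame.X F} {y : Frame.X G} where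

    Agree-sym : Agree m d F θ x G η y → Agree m d G η y F θ x
    Agree-sym ag φ v h = ⇔.sym (ag φ v h)

    Agree-mono : ∀ {d'} → d' ≤ d → Agree m d F θ x G η y → Agree m d' F θ x G η y
    Agree-mono le ag φ v h = ag φ v (≤-trans h le)

    Agree-trans : ∀ {H ζ z} → Agree m d F θ x H ζ z → Agree m d H ζ z G η y → Agree m d F θ x G η y
    Agree-trans ag ag' φ v h = ⇔.trans (ag φ v h) (ag' φ v h)

  Agree-intro : ∀ m d {F θ x G η y} →
    (∀ p → p < m → θ p x ⇔ η p y) →
    (∀ i φ → VarsBelow m φ → md φ < d → Sat F θ x (◇ i φ) ⇔ Sat G η y (◇ i φ)) →
    Agree m d F θ x G η y
  Agree-intro m d onVars onModal = go
    where
    go : Agree m d _ _ _ _ _ _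
    go (var p)  v h       = onVars p v
    go ⊥f       v h       = ⇔.refl
    go (φ ⇒ ψ)  (v , w) h = →-cong-⇔ (go φ v (m⊔n≤o⇒m≤o _ _ h)) (go ψ w (m⊔n≤o⇒n≤o _ _ h))
    go (φ ∧f ψ) (v , w) h = go φ v (m⊔n≤o⇒m≤o _ _ h) ×-⇔ go ψ w (m⊔n≤o⇒n≤o _ _ h)
    go (◇ i φ)  v h       = onModal i φ v h

  profiles-agree : ∀ {F θ x G η y t} φs → t ∈ profiles φs → Sat F θ x t → Sat G η y t →
                   All (λ φ → Sat F θ x φ ⇔ Sat G η y φ) φs
  profiles-agree [] _ _ _ = []
  profiles-agree (φ ∷ φs) t∈ sx sy with ∈-++⁻ (map (φ ∧f_) (profiles φs)) t∈
  ... | inj₁ t∈⁺ with ∈-map⁻ (φ ∧f_) t∈⁺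
  ...   | u , u∈ , refl =
    mk⇔ (λ _ → proj₁ sy) (λ _ → proj₁ sx) ∷ profiles-agree φs u∈ (proj₂ sx) (proj₂ sy)
  profiles-agree (φ ∷ φs) t∈ sx sy | inj₂ t∈⁻ with ∈-map⁻ (¬f φ ∧f_) t∈⁻
  ...   | u , u∈ , refl =
    mk⇔ (λ s → contradiction s (proj₁ sx)) (λ s → contradiction s (proj₁ sy)) ∷
    profiles-agree φs u∈ (proj₂ sx) (proj₂ sy)

  module _ (F : Frame k) {m : ℕ} (𝒱 : Fin m → Frame.X F → Set) where
    open Frame F

    Sim-refl : ∀ d {a} → Sim F 𝒱 d a a
    Sim-refl zero    j = ⇔.refl
    Sim-refl (suc d)   = (λ c → ⇔.refl) , (λ i c → ⇔.refl)

    Sim-trans : ∀ d {a b c} → Sim F 𝒱 d a b → Sim F 𝒱 d b c → Sim F 𝒱 d a c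
    Sim-trans zero    s s' j            = ⇔.trans (s j) (s' j)
    Sim-trans (suc d) (s , t) (s' , t') =
      (λ c → ⇔.trans (s c) (s' c)) , (λ i c → ⇔.trans (t i c) (t' i c))

    Sim-suc⇒Sim : ∀ d {a b} → Sim F 𝒱 (suc d) a b → Sim F 𝒱 d a b
    Sim-suc⇒Sim d {a} (s , _) = to (s a) (Sim-refl d)

    Sim-antitone : ∀ {d d'} → d ≤ d' → ∀ {a b} → Sim F 𝒱 d' a b → Sim F 𝒱 d a b
    Sim-antitone {d} le s = go (≤⇒≤′ le) s
      where
      go : ∀ {d'} → d ≤′ d' → ∀ {a b} → Sim F 𝒱 d' a b → Sim F 𝒱 d a b
      go ≤′-refl       s = s
      go (≤′-step le′) s = go le′ (Sim-suc⇒Sim _ s)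

    module _ (θ : Valuation F) (encodes : ∀ j x → 𝒱 j x ⇔ θ (toℕ j) x) where

      Sim⇒Agree : ∀ d {a b} → Sim F 𝒱 d a b → Agree m d F θ a F θ b
      Sim⇒Agree zero {a} {b} s = Agree-intro m zero onVars (λ _ _ _ ())
        where
        onVars : ∀ p → p < m → θ p a ⇔ θ p b
        onVars p p<m = subst (λ q → θ q a ⇔ θ q b) (toℕ-fromℕ< p<m)
          (⇔.trans (⇔.sym (encodes _ a)) (⇔.trans (s (fromℕ< p<m)) (encodes _ b)))
      Sim⇒Agree (suc d) {a} {b} s@(_ , succ) =
        Agree-intro m (suc d) (λ p p<m → Sim⇒Agree d (Sim-suc⇒Sim d s) (var p) p<m z≤n) mods
        where
        mods : ∀ i φ → VarsBelow m φ → md φ < suc d → Sat F θ a (◇ i φ) ⇔ Sat F θ b (◇ i φ)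
        mods i φ v (s≤s h) = mk⇔
          (λ (a' , r , sa') → let (b' , r' , q) = to (succ i a') (a' , r , Sim-refl d)
                              in b' , r' , to (Sim⇒Agree d q φ v h) sa')
          (λ (b' , r , sb') → let (a' , r' , q) = from (succ i b') (b' , r , Sim-refl d)
                              in a' , r' , to (Sim⇒Agree d q φ v h) sb')

  DepthBoundedOn : Frame k → ℕ → Set₁
  DepthBoundedOn F N = ∀ φ → Σ (Fm k) λ ψ → md ψ ≤ N × Valid F (φ ⇔f ψ)

  SimStable : (F : Frame k) → ℕ → Set₁
  SimStable F n = ∀ m (𝒱 : Fin m → Frame.X F → Set) d {a b} → n ≤ d → Sim F 𝒱 n a b → Sim F 𝒱 d a b

  module _ {F : Frame k} {n : ℕ} where

    MdFrameLe⇒SimStable : MdFrameLe F n → SimStable F n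
    MdFrameLe⇒SimStable md≤n m 𝒱 d {a} {b} n≤d s = go (≤⇒≤′ n≤d)
      where
      -- The class of a under ∼_{e+1} is already a class of some ∼_{e'} with e' ≤ n ≤ e.
      Sim-suc : ∀ e → n ≤ e → ∀ {a b} → Sim F 𝒱 e a b → Sim F 𝒱 (suc e) a b
      Sim-suc e n≤e {a} {b} s with md≤n m 𝒱 (suc e) (Sim F 𝒱 (suc e) a) (a , λ _ → ⇔.refl)
      ... | e' , e'≤n , c , class =
        from (class b) (Sim-trans F 𝒱 e' (to (class a) (Sim-refl F 𝒱 (suc e)))
                                         (Sim-antitone F 𝒱 (≤-trans e'≤n n≤e) s))
      go : ∀ {e} → n ≤′ e → Sim F 𝒱 e a b
      go ≤′-refl       = s
      go (≤′-step le′) = Sim-suc _ (≤′⇒≤ le′) (go le′)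

    SimStable⇒MdFrameLe : SimStable F n → MdFrameLe F n
    SimStable⇒MdFrameLe stable m 𝒱 d V (c , class) with d ≤? n
    ... | yes d≤n = d , d≤n , c , class
    ... | no d≰n  = n , ≤-refl , c , λ b →
      mk⇔ (Sim-antitone F 𝒱 n≤d ∘ to (class b)) (from (class b) ∘ stable m 𝒱 d n≤d)
      where
      n≤d : n ≤ d
      n≤d = <⇒≤ (≰⇒> d≰n)

module _ (em : ExcludedMiddle (lsuc lzero)) {k : ℕ} where

  dec : (P : Set) → Dec P
  dec P with em {Lift (lsuc lzero) P}
  ... | yes p = yes (lower p)
  ... | no ¬p = no (¬p ∘ lift)

  module _ (F : Frame k) (θ : Valuation F) where
    open Frame F

    ⋁-elim : ∀ {x} φs → Sat F θ x (⋁ φs) → Any (Sat F θ x) φs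
    ⋁-elim {x} (φ ∷ φs) s with dec (Sat F θ x φ)
    ... | yes sφ = here sφ
    ... | no ¬sφ = there (⋁-elim φs (s ¬sφ))

    ◇some-elim : ∀ {x φ} → Sat F θ x (◇some φ) → Σ (Fin k) λ i → Σ X λ y → R i x y × Sat F θ y φ
    ◇some-elim {φ = φ} s = satisfied (Any-map⁻ (⋁-elim (map (λ i → ◇ i φ) (allFin k)) s))

    ◇≤-elim : ∀ j {x φ} → Sat F θ x (◇≤ j φ) → Σ X λ w → Reach≤ F j x w × Sat F θ w φ
    ◇≤-elim zero {x} s = x , done , s
    ◇≤-elim (suc j) {x} {φ} s with dec (Sat F θ x φ)
    ... | yes sφ = x , done , sφ
    ... | no ¬sφ with ◇some-elim (s ¬sφ)
    ... | i , y , r , s' with ◇≤-elim j s'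
    ... | w , p , sw = w , step i r p , sw

  signed : {P : Set} → Dec P → Fm k → Fm k
  signed (yes _) φ = φ
  signed (no _)  φ = ¬f φ

  profile : (F : Frame k) → Valuation F → Frame.X F → List (Fm k) → Fm k
  profile F θ x []       = ⊤f
  profile F θ x (φ ∷ φs) = signed (dec (Sat F θ x φ)) φ ∧f profile F θ x φs

  module _ {F : Frame k} {θ : Valuation F} {x : Frame.X F} where

    profile∈profiles : ∀ φs → profile F θ x φs ∈ profiles φs
    profile∈profiles []       = here refl
    profile∈profiles (φ ∷ φs) with dec (Sat F θ x φ)
    ... | yes _ = ∈-++⁺ˡ (∈-map⁺ (φ ∧f_) (profile∈profiles φs))
    ... | no _  = ∈-++⁺ʳ (map (φ ∧f_) (profiles φs)) (∈-map⁺ (¬f φ ∧f_) (profile∈profiles φs))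

    profile-holds : ∀ φs → Sat F θ x (profile F θ x φs)
    profile-holds []       = λ ()
    profile-holds (φ ∷ φs) with dec (Sat F θ x φ)
    ... | yes sφ = sφ , profile-holds φs
    ... | no ¬sφ = ¬sφ , profile-holds φs

  hintikka : (F : Frame k) → Valuation F → ℕ → ℕ → Frame.X F → Fm k
  hintikka F θ m d x = profile F θ x (basis m d)

  hintikka∈hintikkas : ∀ {F θ} m d x → hintikka F θ m d x ∈ hintikkas m d
  hintikka∈hintikkas m d x = profile∈profiles (basis m d)

  hintikka-holds : ∀ {F θ} m d x → Sat F θ x (hintikka F θ m d x)
  hintikka-holds m d x = profile-holds (basis m d)

  hintikkas-determine : ∀ m d {F θ x G η y t} → t ∈ hintikkas m d →
                        Sat F θ x t → Sat G η y t → Agree m d F θ x G η y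
  basis-◇-transfer : ∀ m d {F θ x G η y} → All (λ φ → Sat F θ x φ ⇔ Sat G η y φ) (basis m (suc d)) →
                     ∀ i φ → VarsBelow m φ → md φ ≤ d → Sat F θ x (◇ i φ) → Sat G η y (◇ i φ)

  hintikkas-determine m d t∈ sx sy =
    Agree-intro m d (λ p p<m → All.lookup agree (var∈basis d p<m)) (onModal d agree)
    where
    agree = profiles-agree (basis m d) t∈ sx sy
    onModal : ∀ e {F θ x G η y} → All (λ φ → Sat F θ x φ ⇔ Sat G η y φ) (basis m e) →
              ∀ i φ → VarsBelow m φ → md φ < e → Sat F θ x (◇ i φ) ⇔ Sat G η y (◇ i φ)
    onModal (suc e) A i φ v (s≤s h) =
      mk⇔ (basis-◇-transfer m e A i φ v h) (basis-◇-transfer m e (All.map ⇔.sym A) i φ v h)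

  basis-◇-transfer m d agree i φ v h (x' , r , sx') =
    let t∈ = hintikka∈hintikkas m d x'
        (y' , r' , sy') = to (All.lookup agree (∈-++⁺ʳ (vars m) (◇∈diamonds i t∈)))
                             (x' , r , hintikka-holds m d x')
    in y' , r' , to (hintikkas-determine m d t∈ (hintikka-holds m d x') sy' φ v h) sx'

  hintikka-determines : ∀ {F θ G η} m d x {y} → Sat G η y (hintikka F θ m d x) → Agree m d F θ x G η y
  hintikka-determines m d x = hintikkas-determine m d (hintikka∈hintikkas m d x) (hintikka-holds m d x)

  module _ (F : Frame k) {m : ℕ} (𝒱 : Fin m → Frame.X F → Set)
           (θ : Valuation F) (encodes : ∀ j x → 𝒱 j x ⇔ θ (toℕ j) x) where
    open Frame F

    Agree⇒Sim : ∀ d {a b} → Agree m d F θ a F θ b → Sim F 𝒱 d a b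
    Agree⇒Sim zero {a} {b} ag j =
      ⇔.trans (encodes j a) (⇔.trans (ag (var (toℕ j)) (toℕ<n j) z≤n) (⇔.sym (encodes j b)))
    Agree⇒Sim (suc d) {a} {b} ag =
      (λ c → mk⇔ (λ q → Agree⇒Sim d (Agree-trans (Sim⇒Agree F 𝒱 θ encodes d q) ag-d))
                 (λ q → Agree⇒Sim d (Agree-trans (Sim⇒Agree F 𝒱 θ encodes d q) (Agree-sym ag-d)))) ,
      (λ i c → mk⇔ (succ ag i c) (succ (Agree-sym ag) i c))
      where
      ag-d : Agree m d F θ a F θ b
      ag-d = Agree-mono (n≤1+n d) ag
      succ : ∀ {a b} → Agree m (suc d) F θ a F θ b → ∀ i c →
             (Σ X λ a' → R i a a' × Sim F 𝒱 d c a') → (Σ X λ b' → R i b b' × Sim F 𝒱 d c b')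
      succ ag i c (a' , r , q) =
        let χ = hintikka F θ m d c
            (md≤ , v) = All.lookup (hintikkas-bounded m d) (hintikka∈hintikkas m d c)
            sa' = to (Sim⇒Agree F 𝒱 θ encodes d q χ v md≤) (hintikka-holds m d c)
            (b' , r' , sb') = to (ag (◇ i χ) v (s≤s md≤)) (a' , r , sa')
        in b' , r' , Agree⇒Sim d (hintikka-determines m d c sb')

  Agree-stable : ∀ {F : Frame k} {n m θ a b} → MdFrameLe F n →
                 Agree m n F θ a F θ b → Agreeω m F θ a F θ b
  Agree-stable {F} {n} {m} {θ} md≤n ag φ v =
    Sim⇒Agree F 𝒱 θ encodes (n ⊔ℕ md φ)
      (MdFrameLe⇒SimStable md≤n m 𝒱 (n ⊔ℕ md φ) (m≤m⊔n n (md φ)) (Agree⇒Sim F 𝒱 θ encodes n ag))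
      φ v (m≤n⊔m n (md φ))
    where
    𝒱 : Fin m → Frame.X F → Set
    𝒱 j = θ (toℕ j)
    encodes : ∀ j x → 𝒱 j x ⇔ θ (toℕ j) x
    encodes j x = ⇔.refl

  DepthBoundedOn⇒SimStable : ∀ {F N} → DepthBoundedOn F N → SimStable F N
  DepthBoundedOn⇒SimStable {F} {N} nf m 𝒱 d {c} {b} _ s =
    Agree⇒Sim F 𝒱 θ encodes d (hintikka-determines m d c sb)
    where
    θ = familyValuation 𝒱
    encodes = familyValuation-encodes 𝒱
    χ = hintikka F θ m d c
    ψ = proj₁ (nf χ)
    ψ⁻ = truncateVars m ψ
    equiv : ∀ x → Sat F θ x χ ⇔ Sat F θ x ψ⁻
    equiv x = let (χ⇒ψ , ψ⇒χ) = proj₂ (proj₂ (nf χ)) θ x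
              in ⇔.trans (mk⇔ χ⇒ψ ψ⇒χ) (⇔.sym (Sat-truncateVars F θ m (familyValuation-vanishes 𝒱) ψ x))
    sb : Sat F θ b χ
    sb = from (equiv b)
           (to (Sim⇒Agree F 𝒱 θ encodes N s ψ⁻ (VarsBelow-truncateVars m ψ)
                  (≤-trans (md-truncateVars m ψ) (proj₁ (proj₂ (nf χ)))))
               (to (equiv c) (hintikka-holds m d c)))

  finiteLogicDepth⇒finiteClassDepth : ∀ {ℓ} (𝓕 : Frame k → Set ℓ) →
                                      LogicDepthFinite 𝓕 → ClassDepthFinite 𝓕
  finiteLogicDepth⇒finiteClassDepth 𝓕 (N , nf) =
    N , λ F F∈𝓕 → SimStable⇒MdFrameLe (DepthBoundedOn⇒SimStable λ φ →
          let (ψ , md≤N , valid) = nf φ in ψ , md≤N , valid F F∈𝓕)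

  reachBound : ℕ → ℕ
  reachBound n = suc (length (hintikkas {k} 1 n))

  module _ {F : Frame k} {n : ℕ} (md≤n : MdFrameLe F n) (a : Frame.X F) where
    open Frame F

    private
      θ : Valuation F
      θ _ w = w ≡ a

      Sat-◇≤ : ∀ j {w} → Sat F θ w (◇≤ j (var 0)) ⇔ Reach≤ F j w a
      Sat-◇≤ j = mk⇔ (reached ∘ ◇≤-elim F θ j) (λ p → ◇≤-intro F θ j p refl)
        where
        reached : ∀ {w} → Σ X (λ w' → Reach≤ F j w w' × w' ≡ a) → Reach≤ F j w a
        reached (_ , p , refl) = p

      ReachedBy : ℕ → Fm k → Set
      ReachedBy j t = Σ X λ w → Sat F θ w t × Reach≤ F j w a

      reachedTypes : ℕ → ℕ
      reachedTypes j = length (filter (dec ∘ ReachedBy j) (hintikkas 1 n))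

      Stable : ℕ → Set
      Stable j = ∀ {w} → Reach≤ F (suc j) w a → Reach≤ F j w a

      Stable-suc : ∀ {j} → Stable j → Stable (suc j)
      Stable-suc st done         = done
      Stable-suc st (step i r p) = step i r (st p)

      unstable-witness : ∀ j → ¬ Stable j → Σ X λ w → Reach≤ F (suc j) w a × ¬ Reach≤ F j w a
      unstable-witness j ¬st with dec (Σ X λ w → Reach≤ F (suc j) w a × ¬ Reach≤ F j w a)
      ... | yes w = w
      ... | no ∄w = contradiction (λ {w} p → decidable-stable (dec _) (λ ¬p → ∄w (_ , p , ¬p))) ¬st

      -- Points with the same n-type agree on every ◇≤ j (var 0), so a point that first
      -- reaches a in j + 1 steps has a type that no point reaching a within j steps has.
      unstable⇒reachedTypes< : ∀ j → ¬ Stable j → reachedTypes j < reachedTypes (suc j)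
      unstable⇒reachedTypes< j ¬st =
        length-filter-strict (dec ∘ ReachedBy j) (dec ∘ ReachedBy (suc j))
          (λ (w , s , p) → w , s , Reach≤-suc F p)
          (hintikka∈hintikkas 1 n w) (w , hintikka-holds 1 n w , p) ¬reached
        where
        w = proj₁ (unstable-witness j ¬st)
        p = proj₁ (proj₂ (unstable-witness j ¬st))
        ¬reached : ¬ ReachedBy j (hintikka F θ 1 n w)
        ¬reached (w' , s , p') = proj₂ (proj₂ (unstable-witness j ¬st)) (to (Sat-◇≤ j)
          (to (Agree-stable md≤n (Agree-sym (hintikka-determines 1 n w s))
                (◇≤ j (var 0)) (VarsBelow-◇≤ j (s≤s z≤n)))
              (from (Sat-◇≤ j) p')))

      stable-or-growing : ∀ j → Stable j ⊎ j ≤ reachedTypes j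
      stable-or-growing zero = inj₂ z≤n
      stable-or-growing (suc j) with dec (Stable j)
      ... | yes st = inj₁ (Stable-suc st)
      ... | no ¬st with stable-or-growing j
      ...   | inj₁ st  = ⊥-elim (¬st st)
      ...   | inj₂ j≤  = inj₂ (≤-trans (s≤s j≤) (unstable⇒reachedTypes< j ¬st))

      stable-beyond : ∀ {j} → reachBound n ≤′ j → Stable j
      stable-beyond ≤′-refl with stable-or-growing (reachBound n)
      ... | inj₁ st = st
      ... | inj₂ H≤ =
        contradiction (≤-trans H≤ (length-filter (dec ∘ ReachedBy _) (hintikkas 1 n))) (<-irrefl refl)
      stable-beyond (≤′-step le) = Stable-suc (stable-beyond le)

    pretransitive : ∀ j {w} → Reach≤ F j w a → Reach≤ F (reachBound n) w a
    pretransitive j p with j ≤? reachBound n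
    ... | yes j≤H = Reach≤-mono F j≤H p
    ... | no j≰H  = descend (≤⇒≤′ (<⇒≤ (≰⇒> j≰H))) p
      where
      descend : ∀ {j w} → reachBound n ≤′ j → Reach≤ F j w a → Reach≤ F (reachBound n) w a
      descend ≤′-refl       p = p
      descend (≤′-step le) p = descend le (stable-beyond le p)

  depthBound : ℕ → ℕ
  depthBound n = reachBound n + suc n

  module Zig {n m : ℕ} {F G : Frame k} (md≤n-F : MdFrameLe F n) (md≤n-G : MdFrameLe G n)
             {θ : Valuation F} {η : Valuation G} {x : Frame.X F} {y : Frame.X G}
             (agree : Agree m (depthBound n) F θ x G η y) where

    Linked : Frame.X F → Frame.X G → Set
    Linked a b = Reach≤ F (reachBound n) x a × Reach≤ G (reachBound n) y b × Agree m n F θ a G η b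

    -- "Within reachBound n steps there is a point of the n-type of a with an Rᵢ-successor of the
    -- n-type of a'" has depth depthBound n, so it holds at y as it does at x.  Pretransitivity
    -- keeps the new pair within reachBound n steps of x and y.
    zig : ∀ {a b i a'} → Linked a b → Frame.R F i a a' →
          Σ (Frame.X G) λ b' → Frame.R G i b b' × Linked a' b'
    zig {a} {b} {i} {a'} (xa , yb , ag) r =
      let (b'' , _ , b''⊨χa , b''⊨◇χa') = ◇≤-elim G η H y⊨◇≤α
          (b' , r' , b'⊨χa') =
            to (Agree-stable md≤n-G (b''~b b''⊨χa) (◇ i (χ a')) (proj₂ (bounded a'))) b''⊨◇χa'
      in b' , r' ,
         pretransitive md≤n-F a' _ (Reach≤-snoc F xa r) ,
         pretransitive md≤n-G b' _ (Reach≤-snoc G yb r') ,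
         hintikka-determines m n a' b'⊨χa'
      where
      H = reachBound n
      χ : Frame.X F → Fm k
      χ = hintikka F θ m n
      bounded : ∀ c → Bounded m n (χ c)
      bounded c = All.lookup (hintikkas-bounded m n) (hintikka∈hintikkas m n c)
      α = χ a ∧f ◇ i (χ a')
      y⊨◇≤α : Sat G η y (◇≤ H α)
      y⊨◇≤α = to (agree (◇≤ H α) (VarsBelow-◇≤ H {φ = α} (proj₂ (bounded a) , proj₂ (bounded a')))
                        (md-◇≤ H {α} (⊔-lub (m≤n⇒m≤1+n (proj₁ (bounded a))) (s≤s (proj₁ (bounded a'))))))
                 (◇≤-intro F θ H xa (hintikka-holds m n a , a' , r , hintikka-holds m n a'))
      b''~b : ∀ {b''} → Sat G η b'' (χ a) → Agree m n G η b'' G η b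
      b''~b b''⊨χa =
        Agree-trans (Agree-sym (hintikka-determines m n a b''⊨χa)) ag

  Agree-transfer : ∀ {n m} {F G : Frame k} → MdFrameLe F n → MdFrameLe G n → ∀ {θ η x y} →
                   Agree m (depthBound n) F θ x G η y → Agreeω m F θ x G η y
  Agree-transfer {n} {m} {F} {G} md≤n-F md≤n-G {θ} {η} agree =
    linked⇒agree (done , done , Agree-mono (≤-trans (n≤1+n n) (m≤n+m (suc n) (reachBound n))) agree)
    where
    open Zig md≤n-F md≤n-G agree
    module Zag = Zig md≤n-G md≤n-F (Agree-sym agree)
    linked⇒agree : ∀ {a b} → Linked a b → Agreeω m F θ a G η b
    linked⇒agree (_ , _ , ag) (var p) v = ag (var p) v z≤n
    linked⇒agree l ⊥f       _       = ⇔.refl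
    linked⇒agree l (φ ⇒ ψ)  (v , w) = →-cong-⇔ (linked⇒agree l φ v) (linked⇒agree l ψ w)
    linked⇒agree l (φ ∧f ψ) (v , w) = linked⇒agree l φ v ×-⇔ linked⇒agree l ψ w
    linked⇒agree l@(xa , yb , ag) (◇ i φ) v = mk⇔
      (λ (a' , r , s) → let (b' , r' , l') = zig l r in b' , r' , to (linked⇒agree l' φ v) s)
      (λ (b' , r , s) → let (a' , r' , (yb' , xa' , ag')) = Zag.zig (yb , xa , Agree-sym ag) r
                         in a' , r' , from (linked⇒agree (xa' , yb' , Agree-sym ag') φ v) s)

  normalForm : ∀ n (φ : Fm k) →
               Σ (Fm k) λ ψ → md ψ ≤ depthBound n × (∀ F → MdFrameLe F n → Valid F (φ ⇔f ψ))
  normalForm n φ = ⋁ realized , md≤ , valid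
    where
    N = depthBound n
    m = suc (maxVar φ)
    Realized : Fm k → Set₁
    Realized t = Σ (Frame k) λ G → MdFrameLe G n × Σ (Valuation G) λ η → Σ (Frame.X G) λ y →
                 Sat G η y t × Sat G η y φ
    realized? : Decidable Realized
    realized? _ = em
    realized = filter realized? (hintikkas m N)
    md≤ : md (⋁ realized) ≤ N
    md≤ = ⋁-closed (md≤-closed N) (All.map proj₁ (All-filter⁺ realized? (hintikkas-bounded m N)))
    valid : ∀ F → MdFrameLe F n → Valid F (φ ⇔f ⋁ realized)
    valid F md≤n θ x = forth , back
      where
      forth : Sat F θ x φ → Sat F θ x (⋁ realized)
      forth sφ = ⋁-intro F θ realized (lose
        (∈-filter⁺ realized? (hintikka∈hintikkas m N x)
                   (F , md≤n , θ , x , hintikka-holds {F} {θ} m N x , sφ))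
        (hintikka-holds m N x))
      back : Sat F θ x (⋁ realized) → Sat F θ x φ
      back sψ with find (⋁-elim F θ realized sψ)
      ... | t , t∈ , sx with ∈-filter⁻ realized? {xs = hintikkas m N} t∈
      ... | t∈L , (G , md≤n-G , η , y , sy , sφ) =
        from (Agree-transfer md≤n md≤n-G (hintikkas-determine m N t∈L sx sy)
                             φ (maxVar<⇒VarsBelow φ ≤-refl)) sφ

  finiteClassDepth⇒finiteLogicDepth : ∀ {ℓ} (𝓕 : Frame k → Set ℓ) →
                                      ClassDepthFinite 𝓕 → LogicDepthFinite 𝓕
  finiteClassDepth⇒finiteLogicDepth 𝓕 (n , md≤n) =
    depthBound n , λ φ → let (ψ , md≤ , valid) = normalForm n φ
                         in ψ , md≤ , λ F F∈𝓕 → valid F (md≤n F F∈𝓕)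

corollary6p19 : ExcludedMiddle (lsuc lzero) → {ℓ : Level} (k : ℕ) (𝓕 : Frame k → Set ℓ) →
                LogicDepthFinite 𝓕 ⇔ ClassDepthFinite 𝓕
corollary6p19 em k 𝓕 =
  mk⇔ (finiteLogicDepth⇒finiteClassDepth em 𝓕) (finiteClassDepth⇒finiteLogicDepth em 𝓕)
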